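{- Let $n\geq 3$ be an integer, and let $\mathbf{d}=(n,n,n,n)\in\mathbb{Z}_+^4$ and $\mathbf{t}=(7,5,2,\ldots,2)\in\mathbb{Z}_+^{2n-4}$ (entries $7$, $5$, followed by $2n-6$ entries equal to $2$). Then the pair $(\mathbf{d};\mathbf{t})$ is realizable, i.e., it is the degree sequence of a geographic plan.
   Context: Graphs are finite and undirected, with loops and multiple edges allowed; a loop contributes $2$ to the degree of its vertex. A map is an embedding of a connected graph $G=(V,E)$ in a compact surface without boundary such that edges meet only at common endpoints and every connected component of the complement of the image (a country) is homeomorphic to an open disk. The dual graph $G^*$ has the countries as vertices and the same edge set $E$: each edge joins the one or two countries on whose boundary it lies. A plan is a pair $(G,H)$ of graphs with a common edge set; it is geographic if there is a map of $G$ such that $H$ is its dual graph $G^*$ (with the given identification of edges). If $G$ has degree sequence $\mathbf{d}$ and $H$ has degree sequence $\mathbf{t}$ (up to ordering), then $(\mathbf{d};\mathbf{t})$ is the degree sequence of the plan. A pair $(\mathbf{d};\mathbf{t})$ is realizable if it is the degree sequence of some geographic plan. -}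

module Defs where

open import Data.Nat using (ℕ; zero; suc; _+_; _*_; _∸_; ⌊_/2⌋)
open import Data.Fin using (Fin)
open import Data.Fin.Properties using (_≟_)
open import Data.List using (List; []; _∷_; map; length; filter; replicate)
open import Data.List.Membership.Propositional using (_∈_)
open import Data.List.Relation.Binary.Permutation.Propositional using (_↭_)
open import Data.Vec.Functional using ()
open import Data.List using (allFin) public
open import Data.Product using (Σ; ∃; _×_; _,_)
open import Function.Bundles using (_⇔_)
open import Relation.Binary.PropositionalEquality using (_≡_; _≢_)

-- Orbit relation of the subgroup generated by a list of permutations
-- (here always involutions) acting on a finite set of flags Fin m.
data Orbit {m : ℕ} (gs : List (Fin m → Fin m)) (x : Fin m) : Fin m → Set where
  here : Orbit gs x x
  step : ∀ {y} (g : Fin m → Fin m) → g ∈ gs → Orbit gs x y → Orbit gs x (g y)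

-- A (combinatorial) map on a closed surface, encoded by its flags
-- (graph-encoded map / generalised map): three fixed-point-free involutions
-- a0 (change vertex), a1 (change edge), a2 (change country) such that
-- a0 and a2 commute and a0 a2 is fixed-point-free, with the generated
-- group transitive (connectedness).  Vertices, edges and countries are
-- the orbits of <a1,a2>, <a0,a2> and <a0,a1> respectively.
record Map (m : ℕ) : Set where
  field
    a0 a1 a2   : Fin m → Fin m
    a0-invol   : ∀ x → a0 (a0 x) ≡ x
    a1-invol   : ∀ x → a1 (a1 x) ≡ x
    a2-invol   : ∀ x → a2 (a2 x) ≡ x
    a0-free    : ∀ x → a0 x ≢ x
    a1-free    : ∀ x → a1 x ≢ x
    a2-free    : ∀ x → a2 x ≢ x
    a0a2-comm  : ∀ x → a0 (a2 x) ≡ a2 (a0 x)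
    a0a2-free  : ∀ x → a0 (a2 x) ≢ x
    connected  : ∀ x y → Orbit (a0 ∷ a1 ∷ a2 ∷ []) x y

  vertexGens : List (Fin m → Fin m)
  vertexGens = a1 ∷ a2 ∷ []

  countryGens : List (Fin m → Fin m)
  countryGens = a0 ∷ a1 ∷ []

flagCount : ∀ {m k} → (Fin m → Fin k) → Fin k → ℕ
flagCount lab i = length (filter (λ x → lab x ≟ i) (allFin _))

IsOrbitLabelling : ∀ {m k} → List (Fin m → Fin m) → (Fin m → Fin k) → Set
IsOrbitLabelling gs lab =
  (∀ x y → (lab x ≡ lab y) ⇔ Orbit gs x y) × (∀ i → ∃ λ x → lab x ≡ i)

-- Degree of a vertex / country = half the number of its flags
-- (each edge-end at a vertex, resp. each edge-side on a country's
-- boundary, carries exactly two flags; loops count twice).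
degreeList : ∀ {m k} → (Fin m → Fin k) → List ℕ
degreeList {k = k} lab = map (λ i → ⌊ flagCount lab i /2⌋) (allFin k)

Realizable : List ℕ → List ℕ → Set
Realizable d t =
  Σ ℕ λ m → Σ (Map m) λ M →
  Σ ℕ λ V → Σ (Fin m → Fin V) λ vert →
  Σ ℕ λ F → Σ (Fin m → Fin F) λ ctry →
    IsOrbitLabelling (Map.vertexGens M) vert ×
    IsOrbitLabelling (Map.countryGens M) ctry ×
    (degreeList vert ↭ d) ×
    (degreeList ctry ↭ t)

-- For n = 3 the pair is realized by an explicit map on the Klein bottle with 24 flags: four
-- trivalent vertices, six edges and two countries of degrees 7 and 5.  Doubling an edge, i.e.
-- adding a parallel copy so that the two copies bound a new digon, raises the degrees of both
-- ends of the edge by one, adds a country of degree 2 and leaves all other degrees unchanged.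
-- Doubling one edge joining vertices 0 and 1 and one joining vertices 2 and 3 therefore turns a
-- realization for n into one for n + 1, and since both edges survive the rounds can be iterated.
module Submission where

open import Algebra.Definitions using (Involutive)
open import Data.Empty using (⊥-elim)
open import Data.Fin using (Fin; zero; suc; #_)
open import Data.Fin.Properties using (_≟_; all?)
open import Data.List using (List; []; _∷_; _++_; replicate; map; concatMap; deduplicate; filter; length; tabulate)
open import Data.List.Properties using (map-tabulate; tabulate-cong)
open import Data.List.Membership.Propositional using (_∈_)
open import Data.List.Relation.Binary.Permutation.Propositional using (_↭_; ↭-reflexive; ↭-trans)
open import Data.List.Relation.Binary.Permutation.Propositional.Properties using (++-comm)
open import Data.List.Relation.Unary.All as All using (All; []; _∷_)
open import Data.List.Relation.Unary.All.Properties using (++⁺; concat⁺; map⁺; deduplicate⁺)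
open import Data.List.Relation.Unary.Any using (here; there; any?)
open import Data.Nat using (ℕ; zero; suc; _+_; _*_; _∸_; _≤_; s≤s; ⌊_/2⌋)
import Data.Nat.Properties as ℕ
open import Data.Nat.Properties using (n≡⌊n+n/2⌋; +-suc; *-suc; *-distribˡ-+; m+n∸m≡n)
open import Data.Product using (_×_; _,_; proj₁; proj₂)
open import Data.Vec as Vec using ([]; _∷_)
open import Function using (_∘_; id)
open import Function.Bundles using (mk⇔)
open import Relation.Binary.PropositionalEquality
  using (_≡_; _≢_; refl; sym; trans; cong; cong₂; subst; module ≡-Reasoning)
open import Relation.Nullary.Decidable using (Dec; yes; no; from-yes; ¬?; _×-dec_)

open import Defs

module _ {m : ℕ} {gs : List (Fin m → Fin m)} where

  orbit-trans : ∀ {x y z} → Orbit gs x y → Orbit gs y z → Orbit gs x z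
  orbit-trans p here          = p
  orbit-trans p (step g g∈ q) = step g g∈ (orbit-trans p q)

  orbit-sym : All (Involutive _≡_) gs → ∀ {x y} → Orbit gs x y → Orbit gs y x
  orbit-sym inv here              = here
  orbit-sym inv (step {y} g g∈ p) =
    orbit-trans (subst (Orbit gs (g y)) (All.lookup inv g∈ y) (step g g∈ here)) (orbit-sym inv p)

  orbit-label : ∀ {k} (lab : Fin m → Fin k) → All (λ g → ∀ x → lab (g x) ≡ lab x) gs →
                ∀ {x y} → Orbit gs x y → lab x ≡ lab y
  orbit-label lab inv here          = refl
  orbit-label lab inv (step g g∈ p) = trans (orbit-label lab inv p) (sym (All.lookup inv g∈ _))

orbit-map : ∀ {m m'} {gs : List (Fin m → Fin m)} {hs : List (Fin m' → Fin m')} (φ : Fin m → Fin m') →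
            All (λ g → ∀ x → Orbit hs (φ x) (φ (g x))) gs →
            ∀ {x y} → Orbit gs x y → Orbit hs (φ x) (φ y)
orbit-map φ sim here          = here
orbit-map φ sim (step g g∈ p) = orbit-trans (orbit-map φ sim p) (All.lookup sim g∈ _)

move-involution : ∀ {A : Set} (h : A → A) → Involutive _≡_ h → ∀ {x y} → h x ≡ y → x ≡ h y
move-involution h inv {x} eq = trans (sym (inv x)) (cong h eq)

module _ {m : ℕ} (gs : List (Fin m → Fin m)) where

  expand : List (Fin m) → List (Fin m)
  expand xs = deduplicate _≟_ (xs ++ concatMap (λ y → map (λ g → g y) gs) xs)

  closure : ℕ → List (Fin m) → List (Fin m)
  closure zero    xs = xs
  closure (suc k) xs = closure k (expand xs)

  closure-sound : ∀ {x} k {xs} → All (Orbit gs x) xs → All (Orbit gs x) (closure k xs)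
  closure-sound zero    ps = ps
  closure-sound (suc k) ps = closure-sound k (deduplicate⁺ _≟_ (++⁺ ps (concat⁺ (map⁺ (All.map neighbours ps)))))
    where
    neighbours : ∀ {x y} → Orbit gs x y → All (Orbit gs x) (map (λ g → g y) gs)
    neighbours p = map⁺ (All.tabulate (λ g∈ → step _ g∈ p))

  -- Only soundness is proved: that the closure exhausts an orbit is checked by evaluation,
  -- with the radius of the orbit as fuel.
  closure-orbit : ∀ k {x y} → y ∈ closure k (x ∷ []) → Orbit gs x y
  closure-orbit k = All.lookup (closure-sound k (here ∷ []))

record OrbitLabelling {m : ℕ} (gs : List (Fin m → Fin m)) (k : ℕ) : Set where
  field
    label     : Fin m → Fin k
    invariant : All (λ g → ∀ x → label (g x) ≡ label x) gs
    rep       : Fin k → Fin m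
    label-rep : ∀ i → label (rep i) ≡ i
    reach     : ∀ x → Orbit gs (rep (label x)) x

  isOrbitLabelling : All (Involutive _≡_) gs → IsOrbitLabelling gs label
  isOrbitLabelling inv = (λ x y → mk⇔ (same-label⇒orbit x y) (orbit-label label invariant)) ,
                         (λ i → rep i , label-rep i)
    where
    same-label⇒orbit : ∀ x y → label x ≡ label y → Orbit gs x y
    same-label⇒orbit x y eq =
      orbit-trans (orbit-sym inv (reach x)) (subst (λ i → Orbit gs (rep i) y) (sym eq) (reach y))

module _ {m k : ℕ} (gs : List (Fin m → Fin m)) (lab : Fin m → Fin k) (rep : Fin k → Fin m) (fuel : ℕ) where

  LabellingCertificate : Set
  LabellingCertificate = All (λ g → ∀ x → lab (g x) ≡ lab x) gs × (∀ i → lab (rep i) ≡ i) ×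
                         (∀ x → x ∈ closure gs fuel (rep (lab x) ∷ []))

  labellingCertificate? : Dec LabellingCertificate
  labellingCertificate? = All.all? (λ g → all? λ x → lab (g x) ≟ lab x) gs ×-dec all? (λ i → lab (rep i) ≟ i) ×-dec
                          all? (λ x → any? (x ≟_) (closure gs fuel (rep (lab x) ∷ [])))

  fromCertificate : LabellingCertificate → OrbitLabelling gs k
  fromCertificate (invariant , label-rep , reach) = record
    { label = lab ; invariant = invariant ; rep = rep ; label-rep = label-rep
    ; reach = λ x → closure-orbit gs fuel (reach x) }

occurrences : ∀ {k} → Fin k → List (Fin k) → ℕ
occurrences i = length ∘ filter (_≟ i)

flagCount-occurrences : ∀ {m k} (lab : Fin m → Fin k) i → flagCount lab i ≡ occurrences i (tabulate lab)
flagCount-occurrences {m} lab i = go id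
  where
  go : ∀ {n} (h : Fin n → Fin m) → length (filter (λ x → lab x ≟ i) (tabulate h)) ≡ occurrences i (tabulate (lab ∘ h))
  go {zero}  h = refl
  go {suc n} h with lab (h zero) ≟ i
  ... | yes _ = cong suc (go (h ∘ suc))
  ... | no _  = go (h ∘ suc)

occurrences-zero-map-suc : ∀ {k} (xs : List (Fin k)) → occurrences zero (map suc xs) ≡ 0
occurrences-zero-map-suc []       = refl
occurrences-zero-map-suc (x ∷ xs) = occurrences-zero-map-suc xs

occurrences-suc-map-suc : ∀ {k} (i : Fin k) xs → occurrences (suc i) (map suc xs) ≡ occurrences i xs
occurrences-suc-map-suc i []       = refl
occurrences-suc-map-suc i (x ∷ xs) with x ≟ i
... | yes _ = cong suc (occurrences-suc-map-suc i xs)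
... | no _  = occurrences-suc-map-suc i xs

degreeList-tabulate : ∀ {m k} (lab : Fin m → Fin k) → degreeList lab ≡ tabulate (λ i → ⌊ flagCount lab i /2⌋)
degreeList-tabulate lab = map-tabulate id _

degreeList-regular : ∀ {m k} (lab : Fin m → Fin k) {n} → (∀ i → flagCount lab i ≡ n + n) → degreeList lab ≡ replicate k n
degreeList-regular lab {n} flags = trans (degreeList-tabulate lab) (trans (tabulate-cong half) (tabulate-const _))
  where
  half : ∀ i → ⌊ flagCount lab i /2⌋ ≡ n
  half i = trans (cong ⌊_/2⌋ (flags i)) (sym (n≡⌊n+n/2⌋ n))
  tabulate-const : ∀ k → tabulate {n = k} (λ _ → n) ≡ replicate k n
  tabulate-const zero    = refl
  tabulate-const (suc k) = cong (n ∷_) (tabulate-const k)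

record LabelledMap (m V F : ℕ) : Set where
  field
    M         : Map m
    vertices  : OrbitLabelling (Map.vertexGens M) V
    countries : OrbitLabelling (Map.countryGens M) F

  open Map M
  open OrbitLabelling

  vertex : Fin m → Fin V
  vertex = label vertices

  country : Fin m → Fin F
  country = label countries

  Joins : Fin m → Fin V → Fin V → Set
  Joins e i j = vertex e ≡ i × vertex (a0 e) ≡ j

  realizes : ∀ {d t} → degreeList vertex ↭ d → degreeList country ↭ t → Realizable d t
  realizes vertex-degrees country-degrees =
    m , M , V , vertex , F , country ,
    isOrbitLabelling vertices (a1-invol ∷ a2-invol ∷ []) ,
    isOrbitLabelling countries (a0-invol ∷ a1-invol ∷ []) ,
    vertex-degrees , country-degrees

-- Flags 4e, ..., 4e + 3 belong to edge e; a2 and a0 flip bits 0 and 1 of a flag.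
module BaseMap where

  a0 a1 a2 : Fin 24 → Fin 24
  a0 = Vec.lookup (# 2 ∷ # 3 ∷ # 0 ∷ # 1 ∷ # 6 ∷ # 7 ∷ # 4 ∷ # 5 ∷ # 10 ∷ # 11 ∷ # 8 ∷ # 9 ∷ # 14 ∷ # 15 ∷ # 12 ∷ # 13 ∷ # 18 ∷ # 19 ∷ # 16 ∷ # 17 ∷ # 22 ∷ # 23 ∷ # 20 ∷ # 21 ∷ [])
  a1 = Vec.lookup (# 3 ∷ # 5 ∷ # 4 ∷ # 0 ∷ # 2 ∷ # 1 ∷ # 12 ∷ # 9 ∷ # 13 ∷ # 7 ∷ # 17 ∷ # 20 ∷ # 6 ∷ # 8 ∷ # 22 ∷ # 18 ∷ # 21 ∷ # 10 ∷ # 15 ∷ # 23 ∷ # 11 ∷ # 16 ∷ # 14 ∷ # 19 ∷ [])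
  a2 = Vec.lookup (# 1 ∷ # 0 ∷ # 3 ∷ # 2 ∷ # 5 ∷ # 4 ∷ # 7 ∷ # 6 ∷ # 9 ∷ # 8 ∷ # 11 ∷ # 10 ∷ # 13 ∷ # 12 ∷ # 15 ∷ # 14 ∷ # 17 ∷ # 16 ∷ # 19 ∷ # 18 ∷ # 21 ∷ # 20 ∷ # 23 ∷ # 22 ∷ [])

  vertex : Fin 24 → Fin 4
  vertex = Vec.lookup (# 0 ∷ # 0 ∷ # 0 ∷ # 0 ∷ # 0 ∷ # 0 ∷ # 1 ∷ # 1 ∷ # 1 ∷ # 1 ∷ # 2 ∷ # 2 ∷ # 1 ∷ # 1 ∷ # 3 ∷ # 3 ∷ # 2 ∷ # 2 ∷ # 3 ∷ # 3 ∷ # 2 ∷ # 2 ∷ # 3 ∷ # 3 ∷ [])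

  country : Fin 24 → Fin 2
  country = Vec.lookup (# 0 ∷ # 0 ∷ # 0 ∷ # 0 ∷ # 0 ∷ # 0 ∷ # 0 ∷ # 0 ∷ # 1 ∷ # 0 ∷ # 1 ∷ # 0 ∷ # 0 ∷ # 1 ∷ # 0 ∷ # 1 ∷ # 1 ∷ # 1 ∷ # 1 ∷ # 1 ∷ # 0 ∷ # 1 ∷ # 0 ∷ # 1 ∷ [])

  map₀ : Map 24
  map₀ = record
    { a0 = a0 ; a1 = a1 ; a2 = a2
    ; a0-invol  = from-yes (all? λ x → a0 (a0 x) ≟ x)
    ; a1-invol  = from-yes (all? λ x → a1 (a1 x) ≟ x)
    ; a2-invol  = from-yes (all? λ x → a2 (a2 x) ≟ x)
    ; a0-free   = from-yes (all? λ x → ¬? (a0 x ≟ x))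
    ; a1-free   = from-yes (all? λ x → ¬? (a1 x ≟ x))
    ; a2-free   = from-yes (all? λ x → ¬? (a2 x ≟ x))
    ; a0a2-comm = from-yes (all? λ x → a0 (a2 x) ≟ a2 (a0 x))
    ; a0a2-free = from-yes (all? λ x → ¬? (a0 (a2 x) ≟ x))
    ; connected = λ x y → orbit-trans (orbit-sym involutive (reach x)) (reach y)
    }
    where
    gens : List (Fin 24 → Fin 24)
    gens = a0 ∷ a1 ∷ a2 ∷ []
    involutive : All (Involutive _≡_) gens
    involutive = from-yes (All.all? (λ g → all? λ x → g (g x) ≟ x) gens)
    reach : ∀ x → Orbit gens zero x
    reach x = closure-orbit gens 8 (from-yes (all? λ y → any? (y ≟_) (closure gens 8 (zero ∷ []))) x)

  base : LabelledMap 24 4 2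
  base = record
    { M = map₀
    ; vertices  = fromCertificate (a1 ∷ a2 ∷ []) vertex vertexRep 3
                    (from-yes (labellingCertificate? (a1 ∷ a2 ∷ []) vertex vertexRep 3))
    ; countries = fromCertificate (a0 ∷ a1 ∷ []) country countryRep 7
                    (from-yes (labellingCertificate? (a0 ∷ a1 ∷ []) country countryRep 7))
    }
    where
    vertexRep : Fin 4 → Fin 24
    vertexRep = Vec.lookup (# 0 ∷ # 6 ∷ # 10 ∷ # 14 ∷ [])
    countryRep : Fin 2 → Fin 24
    countryRep = Vec.lookup (# 0 ∷ # 8 ∷ [])

pattern n0 = zero
pattern n1 = suc zero
pattern n2 = suc (suc zero)
pattern n3 = suc (suc (suc zero))
pattern old x = suc (suc (suc (suc x)))

old-injective : ∀ {m} {x y : Fin m} → _≡_ {A = Fin (4 + m)} (old x) (old y) → x ≡ y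
old-injective refl = refl

-- The edge with flags f, f' = a0 f, g = a2 f, g' = a2 f' gets a parallel copy with flags
-- n0, n1 (at the end of f) and n2, n3 (at the end of f').  The new α2 glues them to the four
-- old flags, so {n0, n1, n2, n3} is a new digon country and every other orbit is unchanged.
module EdgeDoubling {m : ℕ} (M : Map m) (f : Fin m) where
  open Map M

  f' g g' : Fin m
  f' = a0 f
  g  = a2 f
  g' = a2 f'

  a0-g : a0 g ≡ g'
  a0-g = a0a2-comm f

  a0-g' : a0 g' ≡ g
  a0-g' = trans (a0a2-comm f') (cong a2 (a0-invol f))

  f≢f' : f ≢ f'
  f≢f' = a0-free f ∘ sym

  f≢g : f ≢ g
  f≢g = a2-free f ∘ sym

  f≢g' : f ≢ g'
  f≢g' eq = a0a2-free f (trans (a0a2-comm f) (sym eq))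

  f'≢g : f' ≢ g
  f'≢g eq = a0a2-free f (trans (cong a0 (sym eq)) (a0-invol f))

  f'≢g' : f' ≢ g'
  f'≢g' = a2-free f' ∘ sym

  g≢g' : g ≢ g'
  g≢g' eq = f≢f' (trans (move-involution a2 a2-invol eq) (a2-invol f'))

  OffEdge : Fin m → Set
  OffEdge x = x ≢ f × x ≢ f' × x ≢ g × x ≢ g'

  a0-off : ∀ {x} → OffEdge x → OffEdge (a0 x)
  a0-off (x≢f , x≢f' , x≢g , x≢g') =
    (λ eq → x≢f' (move-involution a0 a0-invol eq)) ,
    (λ eq → x≢f (trans (move-involution a0 a0-invol eq) (a0-invol f))) ,
    (λ eq → x≢g' (trans (move-involution a0 a0-invol eq) a0-g)) ,
    (λ eq → x≢g (trans (move-involution a0 a0-invol eq) a0-g'))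

  a2-off : ∀ {x} → OffEdge x → OffEdge (a2 x)
  a2-off (x≢f , x≢f' , x≢g , x≢g') =
    (λ eq → x≢g (move-involution a2 a2-invol eq)) ,
    (λ eq → x≢g' (move-involution a2 a2-invol eq)) ,
    (λ eq → x≢f (trans (move-involution a2 a2-invol eq) (a2-invol f))) ,
    (λ eq → x≢f' (trans (move-involution a2 a2-invol eq) (a2-invol f')))

  data EdgeView (x : Fin m) : Set where
    at-f  : x ≡ f  → EdgeView x
    at-f' : x ≡ f' → EdgeView x
    at-g  : x ≡ g  → EdgeView x
    at-g' : x ≡ g' → EdgeView x
    off   : OffEdge x → EdgeView x

  edgeView : ∀ x → EdgeView x
  edgeView x with x ≟ f | x ≟ f' | x ≟ g | x ≟ g'
  ... | yes p   | _       | _       | _       = at-f p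
  ... | no _    | yes p   | _       | _       = at-f' p
  ... | no _    | no _    | yes p   | _       = at-g p
  ... | no _    | no _    | no _    | yes p   = at-g' p
  ... | no x≢f  | no x≢f' | no x≢g  | no x≢g' = off (x≢f , x≢f' , x≢g , x≢g')

  α2-view : ∀ {x} → EdgeView x → Fin (4 + m)
  α2-view (at-f _)    = n0
  α2-view (at-g _)    = n1
  α2-view (at-f' _)   = n2
  α2-view (at-g' _)   = n3
  α2-view {x} (off _) = old (a2 x)

  α0 α1 α2 : Fin (4 + m) → Fin (4 + m)
  α0 n0      = n2
  α0 n1      = n3
  α0 n2      = n0
  α0 n3      = n1
  α0 (old x) = old (a0 x)
  α1 n0      = n1
  α1 n1      = n0
  α1 n2      = n3
  α1 n3      = n2
  α1 (old x) = old (a1 x)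
  α2 n0      = old f
  α2 n1      = old g
  α2 n2      = old f'
  α2 n3      = old g'
  α2 (old x) = α2-view (edgeView x)

  α2-f : α2 (old f) ≡ n0
  α2-f with edgeView f
  ... | at-f _        = refl
  ... | at-f' p       = ⊥-elim (f≢f' p)
  ... | at-g p        = ⊥-elim (f≢g p)
  ... | at-g' p       = ⊥-elim (f≢g' p)
  ... | off (f≢f , _) = ⊥-elim (f≢f refl)

  α2-f' : α2 (old f') ≡ n2
  α2-f' with edgeView f'
  ... | at-f p              = ⊥-elim (f≢f' (sym p))
  ... | at-f' _             = refl
  ... | at-g p              = ⊥-elim (f'≢g p)
  ... | at-g' p             = ⊥-elim (f'≢g' p)
  ... | off (_ , f'≢f' , _) = ⊥-elim (f'≢f' refl)

  α2-g : α2 (old g) ≡ n1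
  α2-g with edgeView g
  ... | at-f p                = ⊥-elim (f≢g (sym p))
  ... | at-f' p               = ⊥-elim (f'≢g (sym p))
  ... | at-g _                = refl
  ... | at-g' p               = ⊥-elim (g≢g' p)
  ... | off (_ , _ , g≢g , _) = ⊥-elim (g≢g refl)

  α2-g' : α2 (old g') ≡ n3
  α2-g' with edgeView g'
  ... | at-f p                  = ⊥-elim (f≢g' (sym p))
  ... | at-f' p                 = ⊥-elim (f'≢g' (sym p))
  ... | at-g p                  = ⊥-elim (g≢g' (sym p))
  ... | at-g' _                 = refl
  ... | off (_ , _ , _ , g'≢g') = ⊥-elim (g'≢g' refl)

  α2-off : ∀ {x} → OffEdge x → α2 (old x) ≡ old (a2 x)
  α2-off {x} (x≢f , x≢f' , x≢g , x≢g') with edgeView x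
  ... | at-f p  = ⊥-elim (x≢f p)
  ... | at-f' p = ⊥-elim (x≢f' p)
  ... | at-g p  = ⊥-elim (x≢g p)
  ... | at-g' p = ⊥-elim (x≢g' p)
  ... | off _   = refl

  α0-invol : Involutive _≡_ α0
  α0-invol n0      = refl
  α0-invol n1      = refl
  α0-invol n2      = refl
  α0-invol n3      = refl
  α0-invol (old x) = cong old (a0-invol x)

  α1-invol : Involutive _≡_ α1
  α1-invol n0      = refl
  α1-invol n1      = refl
  α1-invol n2      = refl
  α1-invol n3      = refl
  α1-invol (old x) = cong old (a1-invol x)

  α2-invol : Involutive _≡_ α2
  α2-invol n0 = α2-f
  α2-invol n1 = α2-g
  α2-invol n2 = α2-f'
  α2-invol n3 = α2-g'
  α2-invol (old x) with edgeView x
  ... | at-f refl  = refl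
  ... | at-f' refl = refl
  ... | at-g refl  = refl
  ... | at-g' refl = refl
  ... | off o      = trans (α2-off (a2-off o)) (cong old (a2-invol x))

  α0-free : ∀ x → α0 x ≢ x
  α0-free n0 ()
  α0-free n1 ()
  α0-free n2 ()
  α0-free n3 ()
  α0-free (old x) = a0-free x ∘ old-injective

  α1-free : ∀ x → α1 x ≢ x
  α1-free n0 ()
  α1-free n1 ()
  α1-free n2 ()
  α1-free n3 ()
  α1-free (old x) = a1-free x ∘ old-injective

  α2-free : ∀ x → α2 x ≢ x
  α2-free n0 ()
  α2-free n1 ()
  α2-free n2 ()
  α2-free n3 ()
  α2-free (old x) with edgeView x
  ... | at-f refl  = λ ()
  ... | at-f' refl = λ ()
  ... | at-g refl  = λ ()
  ... | at-g' refl = λ ()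
  ... | off _      = a2-free x ∘ old-injective

  α0α2-comm : ∀ x → α0 (α2 x) ≡ α2 (α0 x)
  α0α2-comm n0 = refl
  α0α2-comm n1 = cong old a0-g
  α0α2-comm n2 = cong old (a0-invol f)
  α0α2-comm n3 = cong old a0-g'
  α0α2-comm (old x) with edgeView x
  ... | at-f refl  = sym α2-f'
  ... | at-f' refl = sym (trans (cong (α2 ∘ old) (a0-invol f)) α2-f)
  ... | at-g refl  = sym (trans (cong (α2 ∘ old) a0-g) α2-g')
  ... | at-g' refl = sym (trans (cong (α2 ∘ old) a0-g') α2-g)
  ... | off o      = trans (cong old (a0a2-comm x)) (sym (α2-off (a0-off o)))

  α0α2-free : ∀ x → α0 (α2 x) ≢ x
  α0α2-free n0 ()
  α0α2-free n1 ()
  α0α2-free n2 ()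
  α0α2-free n3 ()
  α0α2-free (old x) with edgeView x
  ... | at-f refl  = λ ()
  ... | at-f' refl = λ ()
  ... | at-g refl  = λ ()
  ... | at-g' refl = λ ()
  ... | off _      = a0a2-free x ∘ old-injective

  glued : Fin (4 + m) → Fin m
  glued n0      = f
  glued n1      = g
  glued n2      = f'
  glued n3      = g'
  glued (old x) = x

  module _ {hs : List (Fin (4 + m) → Fin (4 + m))} (α1∈ : α1 ∈ hs) (α2∈ : α2 ∈ hs) where

    across-digon : ∀ x {n} → α2 (old x) ≡ n → Orbit hs (old x) (α2 (α1 n))
    across-digon x eq =
      subst (λ z → Orbit hs (old x) (α2 (α1 z))) eq (step α2 α2∈ (step α1 α1∈ (step α2 α2∈ here)))

    old-a2-orbit : ∀ x → Orbit hs (old x) (old (a2 x))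
    old-a2-orbit x with edgeView x
    ... | at-f refl  = across-digon f α2-f
    ... | at-f' refl = across-digon f' α2-f'
    ... | at-g refl  = subst (Orbit hs (old g) ∘ old) (sym (a2-invol f)) (across-digon g α2-g)
    ... | at-g' refl = subst (Orbit hs (old g') ∘ old) (sym (a2-invol f')) (across-digon g' α2-g')
    ... | off o      = subst (Orbit hs _) (α2-off o) (step α2 α2∈ here)

    to-glued : ∀ x → Orbit hs x (old (glued x))
    to-glued n0      = step α2 α2∈ here
    to-glued n1      = step α2 α2∈ here
    to-glued n2      = step α2 α2∈ here
    to-glued n3      = step α2 α2∈ here
    to-glued (old x) = here

  doubled : Map (4 + m)
  doubled = record
    { a0 = α0 ; a1 = α1 ; a2 = α2
    ; a0-invol = α0-invol ; a1-invol = α1-invol ; a2-invol = α2-invol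
    ; a0-free = α0-free ; a1-free = α1-free ; a2-free = α2-free
    ; a0a2-comm = α0α2-comm ; a0a2-free = α0α2-free
    ; connected = λ x y → orbit-trans (to-glued α1∈ α2∈ x)
                            (orbit-trans (orbit-map old lift (connected (glued x) (glued y)))
                              (orbit-sym (α0-invol ∷ α1-invol ∷ α2-invol ∷ []) (to-glued α1∈ α2∈ y)))
    }
    where
    α1∈ : α1 ∈ α0 ∷ α1 ∷ α2 ∷ []
    α1∈ = there (here refl)
    α2∈ : α2 ∈ α0 ∷ α1 ∷ α2 ∷ []
    α2∈ = there (there (here refl))
    lift : All (λ h → ∀ x → Orbit (α0 ∷ α1 ∷ α2 ∷ []) (old x) (old (h x))) (a0 ∷ a1 ∷ a2 ∷ [])
    lift = (λ _ → step α0 (here refl) here) ∷ (λ _ → step α1 α1∈ here) ∷ old-a2-orbit α1∈ α2∈ ∷ []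

  doubledVertices : ∀ {V} → OrbitLabelling vertexGens V → OrbitLabelling (Map.vertexGens doubled) V
  doubledVertices {V} L = record
    { label = vertex'
    ; invariant = vertex'-α1 ∷ vertex'-α2 ∷ []
    ; rep = old ∘ rep
    ; label-rep = label-rep
    ; reach = reach'
    }
    where
    open OrbitLabelling L renaming (label to vertex)
    vertex-a1 : ∀ x → vertex (a1 x) ≡ vertex x
    vertex-a2 : ∀ x → vertex (a2 x) ≡ vertex x
    vertex-a1 = All.lookup invariant (here refl)
    vertex-a2 = All.lookup invariant (there (here refl))

    vertex' : Fin (4 + m) → Fin V
    vertex' n0      = vertex f
    vertex' n1      = vertex f
    vertex' n2      = vertex f'
    vertex' n3      = vertex f'
    vertex' (old x) = vertex x

    vertex'-α1 : ∀ x → vertex' (α1 x) ≡ vertex' x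
    vertex'-α1 n0      = refl
    vertex'-α1 n1      = refl
    vertex'-α1 n2      = refl
    vertex'-α1 n3      = refl
    vertex'-α1 (old x) = vertex-a1 x

    vertex'-α2 : ∀ x → vertex' (α2 x) ≡ vertex' x
    vertex'-α2 n0 = refl
    vertex'-α2 n1 = vertex-a2 f
    vertex'-α2 n2 = refl
    vertex'-α2 n3 = vertex-a2 f'
    vertex'-α2 (old x) with edgeView x
    ... | at-f refl  = refl
    ... | at-f' refl = refl
    ... | at-g refl  = sym (vertex-a2 f)
    ... | at-g' refl = sym (vertex-a2 f')
    ... | off _      = vertex-a2 x

    α1∈ : α1 ∈ α1 ∷ α2 ∷ []
    α1∈ = here refl
    α2∈ : α2 ∈ α1 ∷ α2 ∷ []
    α2∈ = there (here refl)

    reach-old : ∀ x → Orbit (α1 ∷ α2 ∷ []) (old (rep (vertex x))) (old x)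
    reach-old x = orbit-map old ((λ _ → step α1 α1∈ here) ∷ old-a2-orbit α1∈ α2∈ ∷ []) (reach x)

    reach' : ∀ x → Orbit (α1 ∷ α2 ∷ []) (old (rep (vertex' x))) x
    reach' n0      = orbit-trans (reach-old f) (orbit-sym (α1-invol ∷ α2-invol ∷ []) (to-glued α1∈ α2∈ n0))
    reach' n1      = step α1 α1∈ (reach' n0)
    reach' n2      = orbit-trans (reach-old f') (orbit-sym (α1-invol ∷ α2-invol ∷ []) (to-glued α1∈ α2∈ n2))
    reach' n3      = step α1 α1∈ (reach' n2)
    reach' (old x) = reach-old x

  doubledCountries : ∀ {F} → OrbitLabelling countryGens F → OrbitLabelling (Map.countryGens doubled) (suc F)
  doubledCountries {F} L = record
    { label = country'
    ; invariant = country'-α0 ∷ country'-α1 ∷ []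
    ; rep = rep'
    ; label-rep = label-rep'
    ; reach = reach'
    }
    where
    open OrbitLabelling L renaming (label to country)

    country' : Fin (4 + m) → Fin (suc F)
    country' n0      = zero
    country' n1      = zero
    country' n2      = zero
    country' n3      = zero
    country' (old x) = suc (country x)

    country'-α0 : ∀ x → country' (α0 x) ≡ country' x
    country'-α0 n0      = refl
    country'-α0 n1      = refl
    country'-α0 n2      = refl
    country'-α0 n3      = refl
    country'-α0 (old x) = cong suc (All.lookup invariant (here refl) x)

    country'-α1 : ∀ x → country' (α1 x) ≡ country' x
    country'-α1 n0      = refl
    country'-α1 n1      = refl
    country'-α1 n2      = refl
    country'-α1 n3      = refl
    country'-α1 (old x) = cong suc (All.lookup invariant (there (here refl)) x)

    rep' : Fin (suc F) → Fin (4 + m)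
    rep' zero    = n0
    rep' (suc i) = old (rep i)

    label-rep' : ∀ i → country' (rep' i) ≡ i
    label-rep' zero    = refl
    label-rep' (suc i) = cong suc (label-rep i)

    α0∈ : α0 ∈ α0 ∷ α1 ∷ []
    α0∈ = here refl
    α1∈ : α1 ∈ α0 ∷ α1 ∷ []
    α1∈ = there (here refl)

    reach' : ∀ x → Orbit (α0 ∷ α1 ∷ []) (rep' (country' x)) x
    reach' n0      = here
    reach' n1      = step α1 α1∈ here
    reach' n2      = step α0 α0∈ here
    reach' n3      = step α0 α0∈ (step α1 α1∈ here)
    reach' (old x) = orbit-map old ((λ _ → step α0 α0∈ here) ∷ (λ _ → step α1 α1∈ here) ∷ []) (reach x)

  degreeList-doubledCountries : ∀ {F} (L : OrbitLabelling countryGens F) →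
    degreeList (OrbitLabelling.label (doubledCountries L)) ≡ 2 ∷ degreeList (OrbitLabelling.label L)
  degreeList-doubledCountries {F} L = begin
    degreeList country'                                ≡⟨ degreeList-tabulate country' ⟩
    ⌊ flagCount country' zero /2⌋ ∷ tabulate (λ j → ⌊ flagCount country' (suc j) /2⌋)
      ≡⟨ cong₂ _∷_ (cong ⌊_/2⌋ digon-flags) (tabulate-cong (cong ⌊_/2⌋ ∘ old-country-flags)) ⟩
    2 ∷ tabulate (λ j → ⌊ flagCount country j /2⌋)   ≡⟨ cong (2 ∷_) (degreeList-tabulate country) ⟨
    2 ∷ degreeList country                             ∎
    where
    open ≡-Reasoning
    country : Fin m → Fin F
    country = OrbitLabelling.label L

    country' : Fin (4 + m) → Fin (suc F)
    country' = OrbitLabelling.label (doubledCountries L)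

    digon-flags : flagCount country' zero ≡ 4
    digon-flags = begin
      flagCount country' zero                            ≡⟨ flagCount-occurrences country' zero ⟩
      4 + occurrences zero (tabulate (suc ∘ country))    ≡⟨ cong (λ xs → 4 + occurrences zero xs) (map-tabulate country suc) ⟨
      4 + occurrences zero (map suc (tabulate country))  ≡⟨ cong (4 +_) (occurrences-zero-map-suc (tabulate country)) ⟩
      4                                                  ∎

    old-country-flags : ∀ j → flagCount country' (suc j) ≡ flagCount country j
    old-country-flags j = begin
      flagCount country' (suc j)                        ≡⟨ flagCount-occurrences country' (suc j) ⟩
      occurrences (suc j) (tabulate (suc ∘ country))    ≡⟨ cong (occurrences (suc j)) (map-tabulate country suc) ⟨
      occurrences (suc j) (map suc (tabulate country))  ≡⟨ occurrences-suc-map-suc j (tabulate country) ⟩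
      occurrences j (tabulate country)                  ≡⟨ flagCount-occurrences country j ⟨
      flagCount country j                               ∎

double : ∀ {m V F} → LabelledMap m V F → Fin m → LabelledMap (4 + m) V (suc F)
double L f = record
  { M = doubled ; vertices = doubledVertices vertices ; countries = doubledCountries countries }
  where
  open LabelledMap L
  open EdgeDoubling M f

degreeList-double : ∀ {m V F} (L : LabelledMap m V F) f →
  degreeList (LabelledMap.country (double L f)) ≡ 2 ∷ degreeList (LabelledMap.country L)
degreeList-double L f = EdgeDoubling.degreeList-doubledCountries (LabelledMap.M L) f (LabelledMap.countries L)

occurrences-each-twice : ∀ {a b c d : Fin 4} → a ≡ # 0 → b ≡ # 1 → c ≡ # 2 → d ≡ # 3 →
  ∀ i xs → occurrences i (a ∷ a ∷ b ∷ b ∷ c ∷ c ∷ d ∷ d ∷ xs) ≡ 2 + occurrences i xs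
occurrences-each-twice refl refl refl refl n0 xs = refl
occurrences-each-twice refl refl refl refl n1 xs = refl
occurrences-each-twice refl refl refl refl n2 xs = refl
occurrences-each-twice refl refl refl refl n3 xs = refl

record Stage (r : ℕ) : Set where
  field
    flags countries : ℕ
    L               : LabelledMap flags 4 countries
    edgeA edgeB     : Fin flags
    edgeA-joins     : LabelledMap.Joins L edgeA (# 0) (# 1)
    edgeB-joins     : LabelledMap.Joins L edgeB (# 2) (# 3)
    vertex-flags    : ∀ i → flagCount (LabelledMap.vertex L) i ≡ (3 + r) + (3 + r)
    country-degrees : degreeList (LabelledMap.country L) ≡ replicate (2 * r) 2 ++ 7 ∷ 5 ∷ []

stage₀ : Stage 0
stage₀ = record
  { L = BaseMap.base
  ; edgeA = # 4 ; edgeB = # 16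
  ; edgeA-joins = refl , refl ; edgeB-joins = refl , refl
  ; vertex-flags = from-yes (all? λ i → flagCount BaseMap.vertex i ℕ.≟ 6)
  ; country-degrees = refl
  }

next-stage : ∀ {r} → Stage r → Stage (suc r)
next-stage {r} S = record
  { L = L₂
  ; edgeA = old (old edgeA) ; edgeB = old (old edgeB)
  ; edgeA-joins = edgeA-joins ; edgeB-joins = edgeB-joins
  ; vertex-flags = vertex-flags₂
  ; country-degrees = country-degrees₂
  }
  where
  open Stage S
  open LabelledMap using (vertex; country)
  open ≡-Reasoning

  n : ℕ
  n = 3 + r

  L₂ : LabelledMap (4 + (4 + flags)) 4 (suc (suc countries))
  L₂ = double (double L edgeB) (old edgeA)

  -- The first eight flags of L₂ are the new ones: two at each end of edgeA, then of edgeB.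
  vertex-flags₂ : ∀ i → flagCount (vertex L₂) i ≡ suc n + suc n
  vertex-flags₂ i = begin
    flagCount (vertex L₂) i                  ≡⟨ flagCount-occurrences (vertex L₂) i ⟩
    occurrences i (tabulate (vertex L₂))
      ≡⟨ occurrences-each-twice (proj₁ edgeA-joins) (proj₂ edgeA-joins) (proj₁ edgeB-joins) (proj₂ edgeB-joins)
                                i (tabulate (vertex L)) ⟩
    2 + occurrences i (tabulate (vertex L))  ≡⟨ cong (2 +_) (flagCount-occurrences (vertex L) i) ⟨
    2 + flagCount (vertex L) i               ≡⟨ cong (2 +_) (vertex-flags i) ⟩
    2 + (n + n)                              ≡⟨ cong suc (+-suc n n) ⟨
    suc n + suc n                            ∎

  country-degrees₂ : degreeList (country L₂) ≡ replicate (2 * suc r) 2 ++ 7 ∷ 5 ∷ []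
  country-degrees₂ = begin
    degreeList (country L₂)                   ≡⟨ degreeList-double (double L edgeB) (old edgeA) ⟩
    2 ∷ degreeList (country (double L edgeB)) ≡⟨ cong (2 ∷_) (degreeList-double L edgeB) ⟩
    2 ∷ 2 ∷ degreeList (country L)            ≡⟨ cong (λ ds → 2 ∷ 2 ∷ ds) country-degrees ⟩
    replicate (2 + 2 * r) 2 ++ 7 ∷ 5 ∷ []     ≡⟨ cong (λ k → replicate k 2 ++ 7 ∷ 5 ∷ []) (*-suc 2 r) ⟨
    replicate (2 * suc r) 2 ++ 7 ∷ 5 ∷ []     ∎

stage : ∀ r → Stage r
stage zero    = stage₀
stage (suc r) = next-stage (stage r)

proposition5p2 : (n : ℕ) → 3 ≤ n →
    Realizable (n ∷ n ∷ n ∷ n ∷ []) (7 ∷ 5 ∷ replicate (2 * n ∸ 6) 2)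
proposition5p2 (suc (suc (suc r))) (s≤s (s≤s (s≤s _))) =
  LabelledMap.realizes L
    (↭-reflexive (degreeList-regular (LabelledMap.vertex L) vertex-flags))
    (↭-trans (↭-reflexive country-degrees)
      (↭-trans (++-comm (replicate (2 * r) 2) (7 ∷ 5 ∷ []))
        (↭-reflexive (cong (λ k → 7 ∷ 5 ∷ replicate k 2) digon-count))))
  where
  open Stage (stage r)
  digon-count : 2 * r ≡ 2 * (3 + r) ∸ 6
  digon-count = trans (sym (m+n∸m≡n 6 (2 * r))) (cong (_∸ 6) (sym (*-distribˡ-+ 2 3 r)))
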